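{- In the setting described in the context (for any positive integer $p$), let $\mathsf{h}$ denote the permutation $(\Phi,\ell)\mapsto(h\Phi,\ell)$ of $\mathcal{F}^w(\mathcal{T})\times\mathbb{Z}_{3p}$ and $\mu=\xi_{n+1}\mathsf{h}^{ -3}\xi_{n+1}\mathsf{h}^{2}\xi_{n+1}\mathsf{h}$. Then the orbit of $(\Phi_0,0)$ under $\langle\mu\rangle$ has exactly $p$ elements.
   Context: Let $n\ge2$, $k\in\{1,2,n\}$, and $a\ge 6n+1$ an integer. Let $\Lambda$ be $a\mathbb{Z}^n$ if $k=1$, $a\{x\in\mathbb{Z}^n:\sum x_i\text{ even}\}$ if $k=2$, $a\{x\in\mathbb{Z}^n:\text{all }x_i\text{ of equal parity}\}$ if $k=n$, and let $\mathcal{T}=\{4,3^{n-2},4\}_{(a^k,0^{n-k})}$ be the regular cubic toroid. Its flags are identified with triples $(\sigma,\mathbf{x},t)\in S_n\times\{\pm1\}^n\times(\mathbb{Z}^n/\Lambda)$, base flag $\Phi_0=(\mathrm{id},(1,\dots,1),0)$. Permutations act on the right on $\{1,\dots,n\}$ with $j(\sigma\tau)=(j\sigma)\tau$; $\mathbf{x}^{(i)}$ is $\mathbf{x}$ with $i$-th coordinate negated; $e_i$ standard basis vectors. Monodromy permutations (acting on the left): $r_0(\sigma,\mathbf{x},t)=(\sigma,\mathbf{x}^{(1\sigma)},t)$; $r_i(\sigma,\mathbf{x},t)=((i\ i{+}1)\sigma,\mathbf{x},t)$ for $1\le i\le n-1$; $r_n(\sigma,\mathbf{x},t)=(\sigma,\mathbf{x}^{(n\sigma)},t-x_{n\sigma}e_{n\sigma})$.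 The facet of $(\sigma,\mathbf{x},t)$ is identified with $t$. A flag is white iff $\mathrm{sgn}(\sigma)\prod_i x_i=1$; $\mathcal{F}^w(\mathcal{T})$ is the set of white flags. Let $v_0=(1,2,\dots,n)$, $h(\sigma,\mathbf{x},t)=(\sigma,\mathbf{x},t+(x_1(v_0)_{1\sigma^{ -1}},\dots,x_n(v_0)_{n\sigma^{ -1}}))$, $\bar h=r_0hr_0$. For $i\in\{0,\pm1,\pm2,\pm3\}$ let $\Phi_i=h^i\Phi_0$ and $F_i$ its facet. A flag $(\sigma,\mathbf{x},t)$ contains the vertex $X_H$ iff $t\equiv(0,-3,0,\dots,0)+(\delta_1,\dots,\delta_n)$ with $\delta_j=-1$ if $x_j=-1$ and $\delta_j=0$ otherwise; the facets incident to $X_H$ are $(0,-3,0,\dots,0)+\varepsilon$, $\varepsilon\in\{0,-1\}^n$. For a positive integer $p$, $H=\{(F,1):F\text{ incident to }X_H\}$. For a facet $F$ and $\ell\in\mathbb{Z}_{3p}$ the root flag $\Phi_F$ (white, with facet $F$) is given by the first applicable rule: (1) if $F=F_i$, $i\in\{0,\pm1,\pm2,\pm3\}$, $\Phi_F=\Phi_i$; (2) if $\ell\not\equiv1\pmod3$ and $F$ is the facet of $\bar h^j\Phi$ for a white flag $\Phi$ with facet $F_0$ and $j\in\{\pm1,\pm2,\pm3\}$, $\Phi_F=\bar h^j\Phi$; (3) if $(F,\ell)\in H$, $\Phi_F$ is a fixed chosen white flag containing $F$ and $X_H$; (4) otherwise $\Phi_F=(\mathrm{id},(1,\dots,1),F)$.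 For $i\in\{0,1\}$ let $\rho_i^{(F,\ell)}$ be the unique permutation (written on the right) of the flags with facet $F$ commuting with $r_0,\dots,r_{n-1}$ and mapping $\Phi_F$ to $r_i\Phi_F$. Let $\rho^\ell\Phi=\Phi\rho_0^{(F,\ell)}$ if $(F,\ell)\notin H$, $\rho^\ell\Phi=\Phi\rho_1^{(F,\ell)}$ if $(F,\ell)\in H$ ($F$ the facet of $\Phi$). On $\mathcal{F}^w(\mathcal{T})\times\mathbb{Z}_{3p}$: $\xi_i(\Phi,\ell)=(r_0r_i\Phi,\ell)$ for $1\le i\le n$; $\xi_{n+1}(\Phi,\ell)=(\rho^\ell r_0\Phi,\ell+1)$ if (facet of $\Phi$ is $F_1$, $\ell\equiv0$) or ($F_3$, $\ell\equiv1$) or ($F_0$, $\ell\equiv2$) mod 3; $=(\rho^\ell r_0\Phi,\ell-1)$ if ($F_0$, $\ell\equiv0$) or ($F_1$, $\ell\equiv1$) or ($F_3$, $\ell\equiv2$) mod 3; $=(\rho^\ell r_0\Phi,\ell)$ otherwise. -}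

module Defs where

open import Data.Nat as ℕ using (ℕ; zero; suc)
open import Data.Integer as ℤ using (ℤ; +_; _+_; _-_; _*_; -_; _◃_)
open import Data.Integer.Divisibility using (_∣_)
open import Data.Fin using (Fin; zero; suc; toℕ; fromℕ<; _≟_; _<?_)
open import Data.Fin.Permutation using (Permutation′; _⟨$⟩ʳ_; _⟨$⟩ˡ_; _∘ₚ_; transpose)
import Data.Fin.Permutation as Perm
open import Data.Sign.Base as Sign using (Sign; opposite)
open import Data.Bool using (Bool; true; false; if_then_else_)
open import Data.List using (List; length; filter; cartesianProduct; allFin; foldr; tabulate)
open import Data.Product using (Σ; Σ-syntax; _×_; _,_; proj₁; proj₂)
open import Data.Sum using (_⊎_)
open import Relation.Nullary using (¬_)
open import Relation.Nullary.Decidable using (⌊_⌋; _×-dec_)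
open import Relation.Binary.PropositionalEquality using (_≡_)
open import Data.Nat.Properties using (≤-trans; ≤-refl; n≤1+n)

∑ : ∀ {m} → (Fin m → ℤ) → ℤ
∑ {zero}  f = + 0
∑ {suc m} f = f zero + ∑ (λ i → f (suc i))

_≡_mod_ : ℤ → ℤ → ℕ → Set
x ≡ y mod m = + m ∣ (x - y)

parity : ℕ → Sign
parity zero    = Sign.+
parity (suc m) = opposite (parity m)

pred<self : ∀ {m} → 1 ℕ.≤ m → ℕ.pred m ℕ.< m
pred<self {suc m} _ = ℕ.s≤s ≤-refl

data Kind : Set where
  k=1 k=2 k=n : Kind

-- The toroid {4,3^{n-2},4}_{(a^k,0^{n-k})} and the construction of the
-- paper, for fixed n (with n ≥ 2), k, a and p.

module Toroid (n : ℕ) (n≥2 : 2 ℕ.≤ n) (k : Kind) (a p : ℕ) where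

  Vecℤ : Set
  Vecℤ = Fin n → ℤ

  _⊕_ : Vecℤ → Vecℤ → Vecℤ
  (u ⊕ v) i = u i + v i

  _⊖_ : Vecℤ → Vecℤ → Vecℤ
  (u ⊖ v) i = u i - v i

  InΛ' : Kind → Vecℤ → Set
  InΛ' k=1 d = Σ[ y ∈ Vecℤ ] (∀ i → d i ≡ + a * y i)
  InΛ' k=2 d = Σ[ y ∈ Vecℤ ] ((∀ i → d i ≡ + a * y i) × (+ 2 ∣ ∑ y))
  InΛ' k=n d = Σ[ y ∈ Vecℤ ] ((∀ i → d i ≡ + a * y i)
                              × (∀ i j → + 2 ∣ (y i - y j)))

  InΛ : Vecℤ → Set
  InΛ = InΛ' k

  -- Equality in ℤ^n / Λ (facets are identified with elements of ℤ^n/Λ).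
  _≈Λ_ : Vecℤ → Vecℤ → Set
  u ≈Λ v = InΛ (u ⊖ v)

  -- Coordinates 1, 2 and n (1-based) as elements of Fin n.
  ix1 : Fin n
  ix1 = fromℕ< {0} (≤-trans (ℕ.s≤s ℕ.z≤n) n≥2)

  ix2 : Fin n
  ix2 = fromℕ< {1} n≥2

  ixn : Fin n
  ixn = fromℕ< {ℕ.pred n} (pred<self (≤-trans (ℕ.s≤s ℕ.z≤n) n≥2))

  e : Fin n → Vecℤ
  e i j = if ⌊ j ≟ i ⌋ then + 1 else + 0

  -- Flags (σ, x, t) ∈ S_n × {±1}^n × ℤ^n (t taken modulo Λ).
  -- jσ is written  σ ⟨$⟩ʳ j ; jσ⁻¹ is  σ ⟨$⟩ˡ j ; and
  -- (π ∘ₚ σ) ⟨$⟩ʳ j = σ ⟨$⟩ʳ (π ⟨$⟩ʳ j), i.e. ∘ₚ is the product of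
  -- right-acting permutations.
  record Flag : Set where
    constructor flag
    field
      σ : Permutation′ n
      x : Fin n → Sign
      t : Vecℤ
  open Flag public

  _≈F_ : Flag → Flag → Set
  Φ ≈F Ψ = (∀ j → σ Φ ⟨$⟩ʳ j ≡ σ Ψ ⟨$⟩ʳ j)
         × (∀ j → x Φ j ≡ x Ψ j)
         × (t Φ ≈Λ t Ψ)

  facet : Flag → Vecℤ
  facet = t

  flipAt : Fin n → (Fin n → Sign) → (Fin n → Sign)
  flipAt i y j = if ⌊ j ≟ i ⌋ then opposite (y j) else y j

  signℤ : Sign → ℤ
  signℤ s = s ◃ 1

  r0 : Flag → Flag
  r0 (flag s y u) = flag s (flipAt (s ⟨$⟩ʳ ix1) y) u

  -- rmid i _ is r_{i+1} (1 ≤ i+1 ≤ n-1): σ ↦ (i+1 i+2)σ.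
  rmid : (i : ℕ) → suc (suc i) ℕ.≤ n → Flag → Flag
  rmid i lt (flag s y u) =
    flag (transpose (fromℕ< {i} (≤-trans (n≤1+n _) lt)) (fromℕ< {suc i} lt) ∘ₚ s) y u

  r1 : Flag → Flag
  r1 = rmid 0 n≥2

  rn : Flag → Flag
  rn (flag s y u) = flag s (flipAt m y) (u ⊖ (λ j → signℤ (y m) * e m j))
    where m = s ⟨$⟩ʳ ixn

  inversions : Permutation′ n → ℕ
  inversions s = length (filter
    (λ ij → (proj₁ ij <? proj₂ ij) ×-dec ((s ⟨$⟩ʳ proj₂ ij) <? (s ⟨$⟩ʳ proj₁ ij)))
    (cartesianProduct (allFin n) (allFin n)))

  sgn : Permutation′ n → Sign
  sgn s = parity (inversions s)

  prodSign : (Fin n → Sign) → Sign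
  prodSign y = foldr Sign._*_ Sign.+ (tabulate y)

  White : Flag → Set
  White Φ = sgn (σ Φ) Sign.* prodSign (x Φ) ≡ Sign.+

  shift : Flag → Vecℤ
  shift (flag s y u) j = y j ◃ suc (toℕ (s ⟨$⟩ˡ j))

  h : Flag → Flag
  h Φ = flag (σ Φ) (x Φ) (t Φ ⊕ shift Φ)

  hinv : Flag → Flag
  hinv Φ = flag (σ Φ) (x Φ) (t Φ ⊖ shift Φ)

  hbar : Flag → Flag
  hbar Φ = r0 (h (r0 Φ))

  iter : ℕ → (Flag → Flag) → Flag → Flag
  iter zero    f Φ = Φ
  iter (suc m) f Φ = f (iter m f Φ)

  zpow : (Flag → Flag) → (Flag → Flag) → ℤ → Flag → Flag
  zpow f g (+ m)      = iter m f
  zpow f g ℤ.-[1+ m ] = iter (suc m) g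

  hpow : ℤ → Flag → Flag
  hpow = zpow h hinv

  hbarpow : ℤ → Flag → Flag
  hbarpow = zpow hbar (λ Φ → r0 (hinv (r0 Φ)))

  Φ₀ : Flag
  Φ₀ = flag Perm.id (λ _ → Sign.+) (λ _ → + 0)

  Φat : ℤ → Flag
  Φat i = hpow i Φ₀

  Fat : ℤ → Vecℤ
  Fat i = facet (Φat i)

  I7 : ℤ → Set
  I7 i = (i ≡ + 0) ⊎ (i ≡ + 1) ⊎ (i ≡ - + 1) ⊎ (i ≡ + 2) ⊎ (i ≡ - + 2)
       ⊎ (i ≡ + 3) ⊎ (i ≡ - + 3)

  J6 : ℤ → Set
  J6 j = (j ≡ + 1) ⊎ (j ≡ - + 1) ⊎ (j ≡ + 2) ⊎ (j ≡ - + 2) ⊎ (j ≡ + 3) ⊎ (j ≡ - + 3)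

  baseH : Vecℤ
  baseH j = if ⌊ j ≟ ix2 ⌋ then - + 3 else + 0

  δ : (Fin n → Sign) → Vecℤ
  δ y j with y j
  ... | Sign.- = - + 1
  ... | Sign.+ = + 0

  ContainsXH : Flag → Set
  ContainsXH Φ = t Φ ≈Λ (baseH ⊕ δ (x Φ))

  IncidentXH : Vecℤ → Set
  IncidentXH F = Σ[ ε ∈ (Fin n → Bool) ]
    (F ≈Λ (baseH ⊕ (λ j → if ε j then - + 1 else + 0)))

  -- (F, ℓ) ∈ H, ℓ ∈ ℤ_{3p} represented by an integer.
  InH : Vecℤ → ℤ → Set
  InH F ℓ = IncidentXH F × (ℓ ≡ + 1 mod (3 ℕ.* p))

  Rule1 : Vecℤ → Set
  Rule1 F = Σ[ i ∈ ℤ ] (I7 i × (F ≈Λ Fat i))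

  Rule2Witness : Vecℤ → Flag → ℤ → Set
  Rule2Witness F Ψ j = White Ψ × (facet Ψ ≈Λ Fat (+ 0)) × J6 j
                     × (facet (hbarpow j Ψ) ≈Λ F)

  Rule2 : Vecℤ → ℤ → Set
  Rule2 F ℓ = ¬ (ℓ ≡ + 1 mod 3) × Σ[ Ψ ∈ Flag ] Σ[ j ∈ ℤ ] Rule2Witness F Ψ j

  IsRoot : Vecℤ → ℤ → Flag → Set
  IsRoot F ℓ R =
      (∀ i → I7 i → F ≈Λ Fat i → R ≈F Φat i)
    × (¬ Rule1 F → Rule2 F ℓ →
         Σ[ Ψ ∈ Flag ] Σ[ j ∈ ℤ ] (¬ (ℓ ≡ + 1 mod 3) × Rule2Witness F Ψ j
                                    × (R ≈F hbarpow j Ψ)))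
    × (¬ Rule1 F → ¬ Rule2 F ℓ → InH F ℓ →
         White R × (facet R ≈Λ F) × ContainsXH R)
    × (¬ Rule1 F → ¬ Rule2 F ℓ → ¬ InH F ℓ →
         R ≈F flag Perm.id (λ _ → Sign.+) F)

  IsRootChoice : (Vecℤ → ℤ → Flag) → Set
  IsRootChoice root =
      (∀ F ℓ → IsRoot F ℓ (root F ℓ))
    × (∀ F F' ℓ ℓ' → F ≈Λ F' → ℓ ≡ ℓ' mod (3 ℕ.* p) → root F ℓ ≈F root F' ℓ')

  IsRho : Vecℤ → Flag → (Flag → Flag) → (Flag → Flag) → Set
  IsRho F R s ρ =
      (ρ R ≈F s R)
    × (∀ Φ → facet Φ ≈Λ F →
          (facet (ρ Φ) ≈Λ F)
        × (∀ Ψ → Φ ≈F Ψ → ρ Φ ≈F ρ Ψ)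
        × (ρ (r0 Φ) ≈F r0 (ρ Φ))
        × (∀ i (lt : suc (suc i) ℕ.≤ n) → ρ (rmid i lt Φ) ≈F rmid i lt (ρ Φ)))

  State : Set
  State = Flag × ℤ

  _≈S_ : State → State → Set
  (Φ , ℓ) ≈S (Ψ , m) = (Φ ≈F Ψ) × (ℓ ≡ m mod (3 ℕ.* p))

  Up : State → Set
  Up (Φ , ℓ) = ((facet Φ ≈Λ Fat (+ 1)) × (ℓ ≡ + 0 mod 3))
             ⊎ ((facet Φ ≈Λ Fat (+ 3)) × (ℓ ≡ + 1 mod 3))
             ⊎ ((facet Φ ≈Λ Fat (+ 0)) × (ℓ ≡ + 2 mod 3))

  Down : State → Set
  Down (Φ , ℓ) = ((facet Φ ≈Λ Fat (+ 0)) × (ℓ ≡ + 0 mod 3))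
               ⊎ ((facet Φ ≈Λ Fat (+ 1)) × (ℓ ≡ + 1 mod 3))
               ⊎ ((facet Φ ≈Λ Fat (+ 3)) × (ℓ ≡ + 2 mod 3))

  RhoL : (rho₀ rho₁ : Vecℤ → ℤ → Flag → Flag) → ℤ → Flag → Flag → Set
  RhoL rho₀ rho₁ ℓ Φ Ψ =
      (¬ InH (facet Φ) ℓ → Ψ ≈F rho₀ (facet Φ) ℓ Φ)
    × (InH (facet Φ) ℓ → Ψ ≈F rho₁ (facet Φ) ℓ Φ)

  IsXi : (rho₀ rho₁ : Vecℤ → ℤ → Flag → Flag) → (State → State) → Set
  IsXi rho₀ rho₁ ξ = ∀ Φ ℓ → White Φ →
      RhoL rho₀ rho₁ ℓ (r0 Φ) (proj₁ (ξ (Φ , ℓ)))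
    × (Up (Φ , ℓ) → proj₂ (ξ (Φ , ℓ)) ≡ ℓ + + 1 mod (3 ℕ.* p))
    × (Down (Φ , ℓ) → proj₂ (ξ (Φ , ℓ)) ≡ ℓ - + 1 mod (3 ℕ.* p))
    × (¬ Up (Φ , ℓ) → ¬ Down (Φ , ℓ) → proj₂ (ξ (Φ , ℓ)) ≡ ℓ mod (3 ℕ.* p))

  -- 𝗁 on states and μ = ξ_{n+1} 𝗁^{-3} ξ_{n+1} 𝗁^{2} ξ_{n+1} 𝗁
  -- (composition of maps, rightmost applied first).
  hS : ℤ → State → State
  hS i (Φ , ℓ) = (hpow i Φ , ℓ)

  μ : (State → State) → State → State
  μ ξ z = ξ (hS (- + 3) (ξ (hS (+ 2) (ξ (hS (+ 1) z)))))

  iterS : ℕ → (State → State) → State → State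
  iterS zero    f z = z
  iterS (suc m) f z = f (iterS m f z)

  -- The orbit of z under ⟨f⟩ has exactly q elements (f a permutation of
  -- a finite set): q is the least positive m with f^m z = z.
  OrbitSize : (State → State) → State → ℕ → Set
  OrbitSize f z q = (iterS q f z ≈S z)
                  × (∀ m → 1 ℕ.≤ m → m ℕ.< q → ¬ (iterS m f z ≈S z))

module Submission where

-- Along the orbit of (Φ₀, 0) the three applications of ξ_{n+1} inside μ act on (flags equivalent
-- to) Φ₁, Φ₃ and Φ₀, in this order, with ℓ ≡ 0, 1, 2 (mod 3). These are exactly the "up" cases, and
-- in each of them (F_i, ℓ) ∉ H: for i = 0, 1 because ℓ ≢ 1 (mod 3), for i = 3 because a > 4 keeps F₃
-- away from X_H. So the root flag is Φ_i itself (rule 1), and as ρ₀ commutes with r₀ and sends Φ_i to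
-- r₀Φ_i, the flag ρ₀ r₀ Φ_i is Φ_i again. Hence μ fixes the flag Φ₀ and adds 3 to ℓ, so that
-- μʲ(Φ₀, 0) = (Φ₀, 3j), which is (Φ₀, 0) in ℤ_{3p} for the first time at j = p.

open import Defs
open import Data.Nat as ℕ using (ℕ; zero; suc; _≤_)
import Data.Nat.Properties as ℕ
import Data.Nat.Divisibility as ℕ
open import Data.Integer as ℤ using (ℤ; +_; ∣_∣)
import Data.Integer.Properties as ℤ
import Data.Integer.Divisibility as Unsigned
import Data.Integer.Divisibility.Signed as Signed
open import Data.Integer.Tactic.RingSolver using (solve-∀)
open import Data.Fin using (Fin; zero; suc; toℕ; _≟_)
open import Data.Fin.Permutation using (Permutation′; _⟨$⟩ʳ_; _⟨$⟩ˡ_)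
import Data.Fin.Permutation as Perm
open import Data.Sign.Base as Sign using (Sign)
import Data.Sign.Properties as Sign
open import Data.Bool using (true; false; if_then_else_)
open import Data.List using (length; foldr; tabulate; cartesianProduct; allFin)
import Data.List.Properties as List
import Data.List.Relation.Unary.All as All
open import Data.Product using (_,_; _×_; proj₁; proj₂)
open import Data.Sum using (inj₁; inj₂)
open import Relation.Nullary using (¬_; contradiction)
open import Relation.Nullary.Decidable using (⌊_⌋)
open import Relation.Binary.Bundles using (Setoid)
import Relation.Binary.Reasoning.Setoid as ≈-Reasoning
open import Relation.Binary.Structures using (IsEquivalence)
open import Relation.Binary.PropositionalEquality
  using (_≡_; _≢_; _≗_; refl; sym; trans; cong; cong₂; subst; subst₂; module ≡-Reasoning)

-- Neither x ≡ y mod m (which unfolds to m ∣ ∣ x - y ∣) nor the relations _≈Λ_ and _≈F_ of Defs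
-- determine their arguments, so Agda cannot infer those: hence the explicit arguments and the
-- setoid reasoning throughout.
module Congruence where
  open import Data.Integer using (_+_; _-_; -_)

  ∣-neg : ∀ d x → d Unsigned.∣ x → d Unsigned.∣ - x
  ∣-neg d x = subst (∣ d ∣ ℕ.∣_) (sym (ℤ.∣-i∣≡∣i∣ x))

  ∣-+ : ∀ d x y → d Unsigned.∣ x → d Unsigned.∣ y → d Unsigned.∣ x + y
  ∣-+ d x y d∣x d∣y = Signed.∣⇒∣ᵤ {d} {x + y}
    (Signed.∣m∣n⇒∣m+n (Signed.∣ᵤ⇒∣ {d} {x} d∣x) (Signed.∣ᵤ⇒∣ {d} {y} d∣y))

  module _ {m : ℕ} where

    ≡mod-refl : ∀ {x} → x ≡ x mod m
    ≡mod-refl {x} = subst (λ z → m ℕ.∣ ∣ z ∣) (sym (ℤ.+-inverseʳ x)) (m ℕ.∣0)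

    ≡mod-sym : ∀ {x y} → x ≡ y mod m → y ≡ x mod m
    ≡mod-sym {x} {y} = subst (m ℕ.∣_) (ℤ.∣i-j∣≡∣j-i∣ x y)

    ≡mod-trans : ∀ {x y z} → x ≡ y mod m → y ≡ z mod m → x ≡ z mod m
    ≡mod-trans {x} {y} {z} x≡y y≡z = Signed.∣⇒∣ᵤ {+ m} {x - z}
      (subst (+ m Signed.∣_) (telescope x y z)
        (Signed.∣m∣n⇒∣m+n (Signed.∣ᵤ⇒∣ {+ m} {x - y} x≡y) (Signed.∣ᵤ⇒∣ {+ m} {y - z} y≡z)))
      where
      telescope : ∀ x y z → (x - y) + (y - z) ≡ x - z
      telescope = solve-∀

    ≡mod-isEquivalence : IsEquivalence (λ (x y : ℤ) → x ≡ y mod m)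
    ≡mod-isEquivalence = record
      { refl  = λ {x} → ≡mod-refl {x}
      ; sym   = λ {x} {y} → ≡mod-sym {x} {y}
      ; trans = λ {x} {y} {z} → ≡mod-trans {x} {y} {z}
      }

    ≡mod-+-congʳ : ∀ x y c → x ≡ y mod m → (x + c) ≡ y + c mod m
    ≡mod-+-congʳ x y c = subst (λ z → m ℕ.∣ ∣ z ∣) (cancel x y c)
      where
      cancel : ∀ x y c → x - y ≡ (x + c) - (y + c)
      cancel = solve-∀

    ∣⇒≡0-mod : ∀ {c : ℕ} → m ℕ.∣ c → (+ c) ≡ + 0 mod m
    ∣⇒≡0-mod {c} = subst (m ℕ.∣_) (sym (ℕ.+-identityʳ c))

    ∣-<⇒≡0 : ∀ {d} → m ℕ.∣ d → d ℕ.< m → d ≡ 0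
    ∣-<⇒≡0 {zero}  _   _   = refl
    ∣-<⇒≡0 {suc _} m∣d d<m = contradiction m∣d (ℕ.>⇒∤ d<m)

    ≡mod-residue : ∀ {c c' : ℕ} → c ℕ.< m → c' ℕ.< m → (+ c) ≡ + c' mod m → c ≡ c'
    ≡mod-residue {c} {c'} c<m c'<m m∣d =
      ℤ.+-injective (ℤ.i-j≡0⇒i≡j (+ c) (+ c') (ℤ.∣i∣≡0⇒i≡0 (∣-<⇒≡0 m∣d d<m)))
      where
      d<m : ∣ + c - + c' ∣ ℕ.< m
      d<m = ℕ.≤-<-trans
        (subst (ℕ._≤ c ℕ.⊔ c') (cong ∣_∣ (sym (ℤ.m-n≡m⊖n c c'))) (ℤ.∣m⊝n∣≤m⊔n c c'))
        (ℕ.⊔-lub c<m c'<m)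

  ≡mod-setoid : ℕ → Setoid _ _
  ≡mod-setoid m = record { isEquivalence = ≡mod-isEquivalence {m} }

  ≡mod-weaken : ∀ {d m} x y → d ℕ.∣ m → x ≡ y mod m → x ≡ y mod d
  ≡mod-weaken x y = ℕ.∣-trans

  ≡mod-unique-residue : ∀ {m} x {c c' : ℕ} → c ℕ.< m → c' ℕ.< m →
                        x ≡ + c mod m → x ≡ + c' mod m → c ≡ c'
  ≡mod-unique-residue {m} x {c} {c'} c<m c'<m x≡c x≡c' =
    ≡mod-residue c<m c'<m (≡mod-trans {m} {+ c} {x} {+ c'} (≡mod-sym {m} {x} {+ c} x≡c) x≡c')

  distinct-residues⇒≢mod : ∀ {d m} x {c c' : ℕ} → d ℕ.∣ m → c ℕ.< d → c' ℕ.< d → c ≢ c' →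
                           x ≡ + c mod d → ¬ (x ≡ + c' mod m)
  distinct-residues⇒≢mod x {c' = c'} d∣m c<d c'<d c≢c' x≡c x≡c' =
    c≢c' (≡mod-unique-residue x c<d c'<d x≡c (≡mod-weaken x (+ c') d∣m x≡c'))

  ≡mod-suc : ∀ {d m} x x' c → d ℕ.∣ m → x' ≡ x + + 1 mod m → x ≡ c mod d → x' ≡ c + + 1 mod d
  ≡mod-suc {d} x x' c d∣m x'≡x+1 x≡c = ≡mod-trans {d} {x'} {x + + 1} {c + + 1}
    (≡mod-weaken x' (x + + 1) d∣m x'≡x+1) (≡mod-+-congʳ x c (+ 1) x≡c)

  ≡mod-three-steps : ∀ {m} x x₁ x₂ x₃ → x₁ ≡ x + + 1 mod m → x₂ ≡ x₁ + + 1 mod m →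
                     x₃ ≡ x₂ + + 1 mod m → x₃ ≡ x + + 3 mod m
  ≡mod-three-steps {m} x x₁ x₂ x₃ x₁≡ x₂≡ x₃≡ = begin
    x₃                        ≈⟨ x₃≡ ⟩
    x₂ + + 1                  ≈⟨ ≡mod-+-congʳ x₂ (x₁ + + 1) (+ 1) x₂≡ ⟩
    (x₁ + + 1) + + 1          ≈⟨ ≡mod-+-congʳ (x₁ + + 1) ((x + + 1) + + 1) (+ 1)
                                   (≡mod-+-congʳ x₁ (x + + 1) (+ 1) x₁≡) ⟩
    ((x + + 1) + + 1) + + 1   ≡⟨ +1+1+1 x ⟩
    x + + 3                   ∎
    where
    open ≈-Reasoning (≡mod-setoid m)
    +1+1+1 : ∀ x → ((x + + 1) + + 1) + + 1 ≡ x + + 3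
    +1+1+1 = solve-∀

open Congruence

module Summation where
  open import Data.Integer using (_+_; -_)

  ∑-0 : ∀ {m} → ∑ {m} (λ _ → + 0) ≡ + 0
  ∑-0 {zero}  = refl
  ∑-0 {suc m} = trans (ℤ.+-identityˡ _) (∑-0 {m})

  ∑-neg : ∀ {m} (y : Fin m → ℤ) → ∑ (λ i → - y i) ≡ - ∑ y
  ∑-neg {zero}  y = refl
  ∑-neg {suc m} y = trans (cong (λ s → - y zero + s) (∑-neg (λ i → y (suc i))))
                          (sym (ℤ.neg-distrib-+ (y zero) (∑ (λ i → y (suc i)))))

  ∑-+ : ∀ {m} (y z : Fin m → ℤ) → ∑ (λ i → y i + z i) ≡ ∑ y + ∑ z
  ∑-+ {zero}  y z = refl
  ∑-+ {suc m} y z =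
    trans (cong (λ s → y zero + z zero + s) (∑-+ (λ i → y (suc i)) (λ i → z (suc i))))
          (interchange (y zero) (z zero) _ _)
    where
    interchange : ∀ a b c d → (a + b) + (c + d) ≡ (a + c) + (b + d)
    interchange = solve-∀

open Summation

module ToroidProperties (n : ℕ) (n≥2 : 2 ≤ n) (k : Kind) (a p : ℕ) where
  open Toroid n n≥2 k a p
  open import Data.Integer using (_+_; _-_; -_; _*_)

  InΛ'-resp-≗ : ∀ κ {d d'} → d ≗ d' → InΛ' κ d → InΛ' κ d'
  InΛ'-resp-≗ k=1 d≗d' (y , d≡ay)     = y , λ i → trans (sym (d≗d' i)) (d≡ay i)
  InΛ'-resp-≗ k=2 d≗d' (y , d≡ay , c) = y , (λ i → trans (sym (d≗d' i)) (d≡ay i)) , c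
  InΛ'-resp-≗ k=n d≗d' (y , d≡ay , c) = y , (λ i → trans (sym (d≗d' i)) (d≡ay i)) , c

  InΛ'-0 : ∀ κ → InΛ' κ (λ _ → + 0)
  InΛ'-0 k=1 = (λ _ → + 0) , λ _ → sym (ℤ.*-zeroʳ (+ a))
  InΛ'-0 k=2 = (λ _ → + 0) , (λ _ → sym (ℤ.*-zeroʳ (+ a))) ,
    subst (+ 2 Unsigned.∣_) (sym (∑-0 {n})) (2 ℕ.∣0)
  InΛ'-0 k=n = (λ _ → + 0) , (λ _ → sym (ℤ.*-zeroʳ (+ a))) , λ _ _ → 2 ℕ.∣0

  private
    scaled-neg : ∀ {x z} → x ≡ + a * z → - x ≡ + a * - z
    scaled-neg {z = z} x≡az = trans (cong -_ x≡az) (ℤ.neg-distribʳ-* (+ a) z)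

    scaled-+ : ∀ {x x' z z'} → x ≡ + a * z → x' ≡ + a * z' → x + x' ≡ + a * (z + z')
    scaled-+ {z = z} {z'} x≡az x'≡az' =
      trans (cong₂ _+_ x≡az x'≡az') (sym (ℤ.*-distribˡ-+ (+ a) z z'))

    neg-minus : ∀ x y → - x - - y ≡ - (x - y)
    neg-minus = solve-∀

    +-minus : ∀ x y x' y' → (x + x') - (y + y') ≡ (x - y) + (x' - y')
    +-minus = solve-∀

    scaled⇒∣ : ∀ {x z} → x ≡ + a * z → + a Unsigned.∣ x
    scaled⇒∣ {x} {z} x≡az =
      Signed.∣⇒∣ᵤ {+ a} {x} (Signed.divides z (trans x≡az (ℤ.*-comm (+ a) z)))

  InΛ'-neg : ∀ κ {d} → InΛ' κ d → InΛ' κ (λ i → - d i)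
  InΛ'-neg k=1 (y , d≡ay)     = (λ i → - y i) , λ i → scaled-neg (d≡ay i)
  InΛ'-neg k=2 (y , d≡ay , c) = (λ i → - y i) , (λ i → scaled-neg (d≡ay i)) ,
    subst (+ 2 Unsigned.∣_) (sym (∑-neg y)) (∣-neg (+ 2) (∑ y) c)
  InΛ'-neg k=n (y , d≡ay , c) = (λ i → - y i) , (λ i → scaled-neg (d≡ay i)) ,
    λ i j → subst (+ 2 Unsigned.∣_) (sym (neg-minus (y i) (y j))) (∣-neg (+ 2) (y i - y j) (c i j))

  InΛ'-+ : ∀ κ {d d'} → InΛ' κ d → InΛ' κ d' → InΛ' κ (λ i → d i + d' i)
  InΛ'-+ k=1 (y , d≡ay) (y' , d'≡ay') = (λ i → y i + y' i) , λ i → scaled-+ (d≡ay i) (d'≡ay' i)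
  InΛ'-+ k=2 (y , d≡ay , c) (y' , d'≡ay' , c') = (λ i → y i + y' i) ,
    (λ i → scaled-+ (d≡ay i) (d'≡ay' i)) ,
    subst (+ 2 Unsigned.∣_) (sym (∑-+ y y')) (∣-+ (+ 2) (∑ y) (∑ y') c c')
  InΛ'-+ k=n (y , d≡ay , c) (y' , d'≡ay' , c') = (λ i → y i + y' i) ,
    (λ i → scaled-+ (d≡ay i) (d'≡ay' i)) ,
    λ i j → subst (+ 2 Unsigned.∣_) (sym (+-minus (y i) (y j) (y' i) (y' j)))
                  (∣-+ (+ 2) (y i - y j) (y' i - y' j) (c i j) (c' i j))

  InΛ'-coordinate : ∀ κ {d} → InΛ' κ d → ∀ i → + a Unsigned.∣ d i
  InΛ'-coordinate k=1 (y , d≡ay)     i = scaled⇒∣ (d≡ay i)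
  InΛ'-coordinate k=2 (y , d≡ay , _) i = scaled⇒∣ (d≡ay i)
  InΛ'-coordinate k=n (y , d≡ay , _) i = scaled⇒∣ (d≡ay i)

  private
    diff-self : ∀ x → + 0 ≡ x - x
    diff-self x = sym (ℤ.+-inverseʳ x)

    diff-neg : ∀ x y → - (x - y) ≡ y - x
    diff-neg = solve-∀

    diff-telescope : ∀ x y z → (x - y) + (y - z) ≡ x - z
    diff-telescope = solve-∀

    diff-translate : ∀ x y s → x - y ≡ (x + s) - (y + s)
    diff-translate = solve-∀

    diff-translate⁻ : ∀ x y s → x - y ≡ (x - s) - (y - s)
    diff-translate⁻ = solve-∀

  ≈Λ-reflexive : ∀ {u v} → u ≗ v → u ≈Λ v
  ≈Λ-reflexive {u} {v} u≗v =
    InΛ'-resp-≗ k (λ i → trans (diff-self (u i)) (cong (λ z → u i - z) (u≗v i))) (InΛ'-0 k)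

  ≈Λ-sym : ∀ {u v} → u ≈Λ v → v ≈Λ u
  ≈Λ-sym {u} {v} u≈v = InΛ'-resp-≗ k (λ i → diff-neg (u i) (v i)) (InΛ'-neg k u≈v)

  ≈Λ-trans : ∀ {u v w} → u ≈Λ v → v ≈Λ w → u ≈Λ w
  ≈Λ-trans {u} {v} {w} u≈v v≈w =
    InΛ'-resp-≗ k (λ i → diff-telescope (u i) (v i) (w i)) (InΛ'-+ k u≈v v≈w)

  ≈F-refl : ∀ {Φ} → Φ ≈F Φ
  ≈F-refl {Φ} = (λ _ → refl) , (λ _ → refl) , ≈Λ-reflexive {t Φ} {t Φ} (λ _ → refl)

  ≈F-sym : ∀ {Φ Ψ} → Φ ≈F Ψ → Ψ ≈F Φ
  ≈F-sym {Φ} {Ψ} (σ≡ , x≡ , t≈) =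
    (λ j → sym (σ≡ j)) , (λ j → sym (x≡ j)) , ≈Λ-sym {t Φ} {t Ψ} t≈

  ≈F-trans : ∀ {Φ Ψ Θ} → Φ ≈F Ψ → Ψ ≈F Θ → Φ ≈F Θ
  ≈F-trans {Φ} {Ψ} {Θ} (σ≡ , x≡ , t≈) (σ≡' , x≡' , t≈') =
    (λ j → trans (σ≡ j) (σ≡' j)) , (λ j → trans (x≡ j) (x≡' j)) ,
    ≈Λ-trans {t Φ} {t Ψ} {t Θ} t≈ t≈'

  ≈F-setoid : Setoid _ _
  ≈F-setoid = record
    { Carrier       = Flag
    ; _≈_           = _≈F_
    ; isEquivalence = record
      { refl  = λ {Φ} → ≈F-refl {Φ}
      ; sym   = λ {Φ} {Ψ} → ≈F-sym {Φ} {Ψ}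
      ; trans = λ {Φ} {Ψ} {Θ} → ≈F-trans {Φ} {Ψ} {Θ}
      }
    }

  flipAt-cong : ∀ {i i' y y'} → i ≡ i' → y ≗ y' → flipAt i y ≗ flipAt i' y'
  flipAt-cong {i} refl y≗y' j = cong (λ s → if ⌊ j ≟ i ⌋ then Sign.opposite s else s) (y≗y' j)

  flipAt-involutive : ∀ i y → flipAt i (flipAt i y) ≗ y
  flipAt-involutive i y j with ⌊ j ≟ i ⌋
  ... | true  = Sign.opposite-involutive (y j)
  ... | false = refl

  r0-cong : ∀ {Φ Ψ} → Φ ≈F Ψ → r0 Φ ≈F r0 Ψ
  r0-cong (σ≡ , x≡ , t≈) = σ≡ , flipAt-cong (σ≡ ix1) x≡ , t≈

  r0-involutive : ∀ Φ → r0 (r0 Φ) ≈F Φ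
  r0-involutive Φ =
    (λ _ → refl) , flipAt-involutive (σ Φ ⟨$⟩ʳ ix1) (x Φ) , ≈Λ-reflexive {t Φ} {t Φ} (λ _ → refl)

  ⟨$⟩ˡ-cong : ∀ {s s' : Permutation′ n} →
              (∀ j → s ⟨$⟩ʳ j ≡ s' ⟨$⟩ʳ j) → ∀ j → s ⟨$⟩ˡ j ≡ s' ⟨$⟩ˡ j
  ⟨$⟩ˡ-cong {s} {s'} s≡s' j = begin
    s ⟨$⟩ˡ j                        ≡⟨ cong (s ⟨$⟩ˡ_) (Perm.inverseʳ s') ⟨
    s ⟨$⟩ˡ (s' ⟨$⟩ʳ (s' ⟨$⟩ˡ j))    ≡⟨ cong (s ⟨$⟩ˡ_) (s≡s' (s' ⟨$⟩ˡ j)) ⟨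
    s ⟨$⟩ˡ (s ⟨$⟩ʳ (s' ⟨$⟩ˡ j))     ≡⟨ Perm.inverseˡ s ⟩
    s' ⟨$⟩ˡ j                       ∎
    where open ≡-Reasoning

  shift-cong : ∀ {Φ Ψ} → Φ ≈F Ψ → shift Φ ≗ shift Ψ
  shift-cong {Φ} {Ψ} (σ≡ , x≡ , _) j =
    cong₂ (λ s i → s ℤ.◃ suc (toℕ i)) (x≡ j) (⟨$⟩ˡ-cong {σ Φ} {σ Ψ} σ≡ j)

  h-cong : ∀ {Φ Ψ} → Φ ≈F Ψ → h Φ ≈F h Ψ
  h-cong {Φ} {Ψ} Φ≈Ψ@(σ≡ , x≡ , t≈) = σ≡ , x≡ , InΛ'-resp-≗ k {t Φ ⊖ t Ψ}
    (λ i → trans (diff-translate (t Φ i) (t Ψ i) (shift Φ i))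
                 (cong (λ s → (t Φ i + shift Φ i) - (t Ψ i + s)) (shift-cong {Φ} {Ψ} Φ≈Ψ i)))
    t≈

  hinv-cong : ∀ {Φ Ψ} → Φ ≈F Ψ → hinv Φ ≈F hinv Ψ
  hinv-cong {Φ} {Ψ} Φ≈Ψ@(σ≡ , x≡ , t≈) = σ≡ , x≡ , InΛ'-resp-≗ k {t Φ ⊖ t Ψ}
    (λ i → trans (diff-translate⁻ (t Φ i) (t Ψ i) (shift Φ i))
                 (cong (λ s → (t Φ i - shift Φ i) - (t Ψ i - s)) (shift-cong {Φ} {Ψ} Φ≈Ψ i)))
    t≈

  hinv-h : ∀ Φ → hinv (h Φ) ≈F Φ
  hinv-h Φ = (λ _ → refl) , (λ _ → refl) ,
    ≈Λ-reflexive {t (hinv (h Φ))} {t Φ} (λ i → cancel (t Φ i) (shift Φ i))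
    where
    cancel : ∀ x s → (x + s) - s ≡ x
    cancel = solve-∀

  hinv³-h³ : ∀ Φ → iter 3 hinv (iter 3 h Φ) ≈F Φ
  hinv³-h³ Φ = begin
    hinv (hinv (hinv (h (h (h Φ)))))   ≈⟨ hinv-cong {hinv (hinv (h (h (h Φ))))} {hinv (h (h Φ))}
                                            (hinv-cong {hinv (h (h (h Φ)))} {h (h Φ)} (hinv-h (h (h Φ)))) ⟩
    hinv (hinv (h (h Φ)))              ≈⟨ hinv-cong {hinv (h (h Φ))} {h Φ} (hinv-h (h Φ)) ⟩
    hinv (h Φ)                         ≈⟨ hinv-h Φ ⟩
    Φ                                  ∎
    where open ≈-Reasoning ≈F-setoid

  iter-cong : ∀ j {f} → (∀ {Φ Ψ} → Φ ≈F Ψ → f Φ ≈F f Ψ) →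
              ∀ {Φ Ψ} → Φ ≈F Ψ → iter j f Φ ≈F iter j f Ψ
  iter-cong zero    f-cong Φ≈Ψ = Φ≈Ψ
  iter-cong (suc j) f-cong Φ≈Ψ = f-cong (iter-cong j f-cong Φ≈Ψ)

  Upright : Flag → Set
  Upright Φ = (∀ j → σ Φ ⟨$⟩ʳ j ≡ j) × (∀ j → x Φ j ≡ Sign.+)

  Upright-resp : ∀ {Φ Ψ} → Φ ≈F Ψ → Upright Ψ → Upright Φ
  Upright-resp (σ≡ , x≡ , _) (σ-id , x-+) =
    (λ j → trans (σ≡ j) (σ-id j)) , (λ j → trans (x≡ j) (x-+ j))

  iter-preserves : ∀ (P : Flag → Set) {f} → (∀ {Φ} → P Φ → P (f Φ)) →
                   ∀ j {Φ} → P Φ → P (iter j f Φ)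
  iter-preserves P f-pres zero    PΦ = PΦ
  iter-preserves P f-pres (suc j) PΦ = f-pres (iter-preserves P f-pres j PΦ)

  -- h and h⁻¹ change only the facet, so they preserve Upright definitionally.
  Upright-Φat : ∀ i → Upright (Φat i)
  Upright-Φat (+ j)      = iter-preserves Upright (λ u → u) j ((λ _ → refl) , (λ _ → refl))
  Upright-Φat ℤ.-[1+ j ] = iter-preserves Upright (λ u → u) (suc j) ((λ _ → refl) , (λ _ → refl))

  inversions-id : ∀ {s} → (∀ j → s ⟨$⟩ʳ j ≡ j) → inversions s ≡ 0
  inversions-id {s} s-id = cong length (List.filter-none _
    (All.universal (λ (i , j) (i<j , sj<si) →
                      ℕ.<-asym i<j (subst₂ (λ u v → toℕ u ℕ.< toℕ v) (s-id j) (s-id i) sj<si))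
                   (cartesianProduct (allFin n) (allFin n))))

  prodSign-+ : ∀ {m} (y : Fin m → Sign) → (∀ j → y j ≡ Sign.+) →
               foldr Sign._*_ Sign.+ (tabulate y) ≡ Sign.+
  prodSign-+ {zero}  y y-+ = refl
  prodSign-+ {suc m} y y-+ rewrite y-+ zero = prodSign-+ (λ j → y (suc j)) (λ j → y-+ (suc j))

  Upright⇒White : ∀ {Φ} → Upright Φ → White Φ
  Upright⇒White {Φ} (σ-id , x-+) rewrite inversions-id {σ Φ} σ-id | prodSign-+ (x Φ) x-+ = refl

  IncidentXH-resp : ∀ {F F'} → F ≈Λ F' → IncidentXH F → IncidentXH F'
  IncidentXH-resp {F} {F'} F≈F' (ε , F≈X) =
    ε , ≈Λ-trans {F'} {F} {baseH ⊕ (λ j → if ε j then - + 1 else + 0)} (≈Λ-sym {F} {F'} F≈F') F≈X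

  r0-root-fixed : ∀ {F R ρ} → IsRho F R r0 ρ → facet R ≈Λ F → ∀ {Φ} → Φ ≈F R → ρ (r0 Φ) ≈F Φ
  r0-root-fixed {F} {R} {ρ} (ρR≈r0R , ρ-on-F) R∈F {Φ} Φ≈R = begin
    ρ (r0 Φ)   ≈⟨ proj₁ (proj₂ (ρ-on-F (r0 Φ) Φ∈F)) (r0 R) (r0-cong {Φ} {R} Φ≈R) ⟩
    ρ (r0 R)   ≈⟨ proj₁ (proj₂ (proj₂ (ρ-on-F R R∈F))) ⟩
    r0 (ρ R)   ≈⟨ r0-cong {ρ R} {r0 R} ρR≈r0R ⟩
    r0 (r0 R)  ≈⟨ r0-involutive R ⟩
    R          ≈⟨ Φ≈R ⟨
    Φ          ∎
    where
    open ≈-Reasoning ≈F-setoid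
    Φ∈F : facet Φ ≈Λ F
    Φ∈F = ≈Λ-trans {t Φ} {t R} {F} (proj₂ (proj₂ Φ≈R)) R∈F

  module Dynamics (root : Vecℤ → ℤ → Flag) (rho₀ rho₁ : Vecℤ → ℤ → Flag → Flag)
                  (ξ : State → State)
                  (root-choice : IsRootChoice root)
                  (rho₀-spec : ∀ F ℓ → IsRho F (root F ℓ) r0 (rho₀ F ℓ))
                  (ξ-spec : IsXi rho₀ rho₁ ξ)
                  (F₃-not-incident : ¬ IncidentXH (Fat (+ 3))) where

    GoesUp : ℤ → Flag → ℤ → Set
    GoesUp i Ψ ℓ = (proj₁ (ξ (Ψ , ℓ)) ≈F Φat i) × (proj₂ (ξ (Ψ , ℓ)) ≡ ℓ + + 1 mod (3 ℕ.* p))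

    ξ-goes-up : ∀ i Ψ ℓ → I7 i → Ψ ≈F Φat i → ¬ InH (facet Ψ) ℓ → Up (Ψ , ℓ) → GoesUp i Ψ ℓ
    ξ-goes-up i Ψ ℓ i∈I7 Ψ≈Φi Ψ∉H up = flag-fixed , proj₁ (proj₂ ξ-on-Ψ) up
      where
      F = facet Ψ
      R = root F ℓ
      ξ-on-Ψ = ξ-spec Ψ ℓ (Upright⇒White {Ψ} (Upright-resp {Ψ} {Φat i} Ψ≈Φi (Upright-Φat i)))
      R≈Φi : R ≈F Φat i
      R≈Φi = proj₁ (proj₁ root-choice F ℓ) i i∈I7 (proj₂ (proj₂ Ψ≈Φi))
      Ψ≈R : Ψ ≈F R
      Ψ≈R = ≈F-trans {Ψ} {Φat i} {R} Ψ≈Φi (≈F-sym {R} {Φat i} R≈Φi)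
      flag-fixed : proj₁ (ξ (Ψ , ℓ)) ≈F Φat i
      flag-fixed = begin
        proj₁ (ξ (Ψ , ℓ))     ≈⟨ proj₁ (proj₁ ξ-on-Ψ) Ψ∉H ⟩
        rho₀ F ℓ (r0 Ψ)      ≈⟨ r0-root-fixed {F} {R} {rho₀ F ℓ} (rho₀-spec F ℓ)
                                  (≈Λ-sym {F} {t R} (proj₂ (proj₂ Ψ≈R))) Ψ≈R ⟩
        Ψ                    ≈⟨ Ψ≈Φi ⟩
        Φat i                ∎
        where open ≈-Reasoning ≈F-setoid

    ξ-at-Φ₁ : ∀ Ψ ℓ → Ψ ≈F Φat (+ 1) → ℓ ≡ + 0 mod 3 → GoesUp (+ 1) Ψ ℓ
    ξ-at-Φ₁ Ψ ℓ Ψ≈Φ₁ ℓ≡0 = ξ-goes-up (+ 1) Ψ ℓ (inj₂ (inj₁ refl)) Ψ≈Φ₁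
      (λ (_ , ℓ≡1) →
         distinct-residues⇒≢mod {3} ℓ (ℕ.m∣m*n p) ℕ.z<s (ℕ.s<s ℕ.z<s) (λ ()) ℓ≡0 ℓ≡1)
      (inj₁ (proj₂ (proj₂ Ψ≈Φ₁) , ℓ≡0))

    ξ-at-Φ₃ : ∀ Ψ ℓ → Ψ ≈F Φat (+ 3) → ℓ ≡ + 1 mod 3 → GoesUp (+ 3) Ψ ℓ
    ξ-at-Φ₃ Ψ ℓ Ψ≈Φ₃ ℓ≡1 = ξ-goes-up (+ 3) Ψ ℓ (inj₂ (inj₂ (inj₂ (inj₂ (inj₂ (inj₁ refl)))))) Ψ≈Φ₃
      (λ (Ψ∈X , _) →
         F₃-not-incident (IncidentXH-resp {t Ψ} {Fat (+ 3)} (proj₂ (proj₂ Ψ≈Φ₃)) Ψ∈X))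
      (inj₂ (inj₁ (proj₂ (proj₂ Ψ≈Φ₃) , ℓ≡1)))

    ξ-at-Φ₀ : ∀ Ψ ℓ → Ψ ≈F Φ₀ → ℓ ≡ + 2 mod 3 → GoesUp (+ 0) Ψ ℓ
    ξ-at-Φ₀ Ψ ℓ Ψ≈Φ₀ ℓ≡2 = ξ-goes-up (+ 0) Ψ ℓ (inj₁ refl) Ψ≈Φ₀
      (λ (_ , ℓ≡1) →
         distinct-residues⇒≢mod {3} ℓ (ℕ.m∣m*n p) (ℕ.n<1+n 2) (ℕ.s<s ℕ.z<s) (λ ()) ℓ≡2 ℓ≡1)
      (inj₂ (inj₂ (proj₂ (proj₂ Ψ≈Φ₀) , ℓ≡2)))

    μ-step : ∀ Ψ ℓ → Ψ ≈F Φ₀ → ℓ ≡ + 0 mod 3 →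
             (proj₁ (μ ξ (Ψ , ℓ)) ≈F Φ₀) × (proj₂ (μ ξ (Ψ , ℓ)) ≡ ℓ + + 3 mod (3 ℕ.* p))
    μ-step Ψ ℓ Ψ≈Φ₀ ℓ≡0 =
      proj₁ step₃ ,
      ≡mod-three-steps ℓ ℓ₁ ℓ₂ (proj₂ (ξ (Ψ₃ , ℓ₂))) (proj₂ step₁) (proj₂ step₂) (proj₂ step₃)
      where
      Ψ₁ = h Ψ
      step₁ = ξ-at-Φ₁ Ψ₁ ℓ (h-cong {Ψ} {Φ₀} Ψ≈Φ₀) ℓ≡0
      Ψ₁' = proj₁ (ξ (Ψ₁ , ℓ))
      ℓ₁  = proj₂ (ξ (Ψ₁ , ℓ))
      ℓ₁≡1 : ℓ₁ ≡ + 1 mod 3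
      ℓ₁≡1 = ≡mod-suc ℓ ℓ₁ (+ 0) (ℕ.m∣m*n p) (proj₂ step₁) ℓ≡0

      Ψ₂ = iter 2 h Ψ₁'
      step₂ = ξ-at-Φ₃ Ψ₂ ℓ₁
        (iter-cong 2 {h} (λ {Φ} {Ψ} → h-cong {Φ} {Ψ}) {Ψ₁'} {Φat (+ 1)} (proj₁ step₁)) ℓ₁≡1
      Ψ₂' = proj₁ (ξ (Ψ₂ , ℓ₁))
      ℓ₂  = proj₂ (ξ (Ψ₂ , ℓ₁))
      ℓ₂≡2 : ℓ₂ ≡ + 2 mod 3
      ℓ₂≡2 = ≡mod-suc ℓ₁ ℓ₂ (+ 1) (ℕ.m∣m*n p) (proj₂ step₂) ℓ₁≡1

      Ψ₃ = iter 3 hinv Ψ₂'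
      Ψ₃≈Φ₀ : Ψ₃ ≈F Φ₀
      Ψ₃≈Φ₀ = begin
        iter 3 hinv Ψ₂'           ≈⟨ iter-cong 3 {hinv} (λ {Φ} {Ψ} → hinv-cong {Φ} {Ψ})
                                                  {Ψ₂'} {Φat (+ 3)} (proj₁ step₂) ⟩
        iter 3 hinv (Φat (+ 3))   ≈⟨ hinv³-h³ Φ₀ ⟩
        Φ₀                        ∎
        where open ≈-Reasoning ≈F-setoid
      step₃ = ξ-at-Φ₀ Ψ₃ ℓ₂ Ψ₃≈Φ₀ ℓ₂≡2

    μ-orbit : ∀ j →
              (proj₁ (iterS j (μ ξ) (Φ₀ , + 0)) ≈F Φ₀)
              × (proj₂ (iterS j (μ ξ) (Φ₀ , + 0)) ≡ + (3 ℕ.* j) mod (3 ℕ.* p))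
    μ-orbit zero    = ≈F-refl {Φ₀} , ≡mod-refl {3 ℕ.* p} {+ 0}
    μ-orbit (suc j) = proj₁ step , level
      where
      ℓ = proj₂ (iterS j (μ ξ) (Φ₀ , + 0))
      previous = μ-orbit j
      ℓ≡0 : ℓ ≡ + 0 mod 3
      ℓ≡0 = begin
        ℓ               ≈⟨ ≡mod-weaken ℓ (+ (3 ℕ.* j)) (ℕ.m∣m*n p) (proj₂ previous) ⟩
        + (3 ℕ.* j)     ≈⟨ ∣⇒≡0-mod (ℕ.m∣m*n j) ⟩
        + 0             ∎
        where open ≈-Reasoning (≡mod-setoid 3)
      step = μ-step (proj₁ (iterS j (μ ξ) (Φ₀ , + 0))) ℓ (proj₁ previous) ℓ≡0
      level : proj₂ (iterS (suc j) (μ ξ) (Φ₀ , + 0)) ≡ + (3 ℕ.* suc j) mod (3 ℕ.* p)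
      level = begin
        proj₂ (μ ξ (iterS j (μ ξ) (Φ₀ , + 0)))   ≈⟨ proj₂ step ⟩
        ℓ + + 3                                  ≈⟨ ≡mod-+-congʳ ℓ (+ (3 ℕ.* j)) (+ 3) (proj₂ previous) ⟩
        + (3 ℕ.* j ℕ.+ 3)                        ≡⟨ cong +_ (ℕ.+-comm (3 ℕ.* j) 3) ⟩
        + (3 ℕ.+ 3 ℕ.* j)                        ≡⟨ cong +_ (ℕ.*-suc 3 j) ⟨
        + (3 ℕ.* suc j)                          ∎
        where open ≈-Reasoning (≡mod-setoid (3 ℕ.* p))

    μ-orbit-size : OrbitSize (μ ξ) (Φ₀ , + 0) p
    μ-orbit-size = returns , no-early-return
      where
      returns : iterS p (μ ξ) (Φ₀ , + 0) ≈S (Φ₀ , + 0)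
      returns = proj₁ (μ-orbit p) ,
        ≡mod-trans {3 ℕ.* p} {proj₂ (iterS p (μ ξ) (Φ₀ , + 0))} {+ (3 ℕ.* p)} {+ 0}
                   (proj₂ (μ-orbit p)) (∣⇒≡0-mod ℕ.∣-refl)
      no-early-return : ∀ j → 1 ℕ.≤ j → j ℕ.< p → ¬ (iterS j (μ ξ) (Φ₀ , + 0) ≈S (Φ₀ , + 0))
      no-early-return j j≥1 j<p (_ , ℓ≡0) = ℕ.<⇒≢ (ℕ.*-monoʳ-< 3 j≥1) (sym 3j≡0)
        where
        3j<3p : 3 ℕ.* j ℕ.< 3 ℕ.* p
        3j<3p = ℕ.*-monoʳ-< 3 j<p
        3j≡0 : 3 ℕ.* j ≡ 0
        3j≡0 = ≡mod-unique-residue (proj₂ (iterS j (μ ξ) (Φ₀ , + 0)))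
                 3j<3p (ℕ.≤-<-trans ℕ.z≤n 3j<3p) (proj₂ (μ-orbit j)) ℓ≡0

module _ {m : ℕ} (n≥2 : 2 ≤ suc (suc m)) (k : Kind) (a p : ℕ) where
  open Toroid (suc (suc m)) n≥2 k a p
  open ToroidProperties (suc (suc m)) n≥2 k a p

  -- In the first coordinate F₃ is 3, while the facets at X_H are 0 or -1 there.
  F₃-not-incident : 4 ℕ.< a → ¬ IncidentXH (Fat (+ 3))
  F₃-not-incident 4<a (ε , F₃≈X) with ε zero | InΛ'-coordinate k F₃≈X zero
  ... | true  | a∣4 = ℕ.>⇒∤ 4<a a∣4
  ... | false | a∣3 = ℕ.>⇒∤ (ℕ.<-trans (ℕ.n<1+n 3) 4<a) a∣3

open import Data.Nat using (ℕ; _≤_; _*_; _+_)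

lemma6p10 : ∀ (n : ℕ) (n≥2 : 2 ≤ n) (k : Kind) (a : ℕ) → 6 * n + 1 ≤ a →
    (p : ℕ) → 1 ≤ p →
    let open Toroid n n≥2 k a p in
    (root : Vecℤ → ℤ → Flag) (rho₀ rho₁ : Vecℤ → ℤ → Flag → Flag)
    (ξ : State → State) →
    IsRootChoice root →
    (∀ F ℓ → IsRho F (root F ℓ) r0 (rho₀ F ℓ)) →
    (∀ F ℓ → IsRho F (root F ℓ) r1 (rho₁ F ℓ)) →
    IsXi rho₀ rho₁ ξ →
    OrbitSize (μ ξ) (Φ₀ , + 0) p
lemma6p10 n n≥2@(ℕ.s≤s (ℕ.s≤s _)) k a a≥6n+1 p _ root rho₀ rho₁ ξ root-choice rho₀-spec _ ξ-spec =
  μ-orbit-size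
  where
  4<a : 4 ℕ.< a
  4<a = ℕ.≤-trans (ℕ.m≤m+n 5 8) (ℕ.≤-trans (ℕ.+-monoˡ-≤ 1 (ℕ.*-monoʳ-≤ 6 n≥2)) a≥6n+1)
  open ToroidProperties n n≥2 k a p
  open Dynamics root rho₀ rho₁ ξ root-choice rho₀-spec ξ-spec (F₃-not-incident n≥2 k a p 4<a)
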